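{- A graph $G$ is word-representable if and only if there exists an integer $p$ such that $G$ admits a $p$-complete square-free uniform word-representation.
   Context: For a word $w$ and a set $S$ of letters, $w_S$ is the word obtained from $w$ by deleting all letters not in $S$. Two distinct letters $x,y$ alternate in $w$ if $w_{\{x,y\}}$ is of the form $xyxy\cdots$ or $yxyx\cdots$ (even or odd length). A simple graph $G=(V,E)$ is word-representable if there is a word $w$ over $V$, containing every vertex, such that distinct $x,y$ alternate in $w$ iff $xy\in E$. A word is uniform if every letter occurs in it the same number of times. A square is a factor (block of consecutive letters) $XX$ with $X$ non-empty. A word $w$ contains a $p$-complete square if there is a set $S$ of letters such that $w_S$ contains a square $XX$ with $|X|\ge p$; otherwise $w$ is $p$-complete square-free. A $p$-complete square-free uniform word-representation of $G$ is a uniform word $w$ representing $G$ that is $p$-complete square-free, where $1\le p\le\lceil|w|/2\rceil$. -}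

module Defs where

open import Data.Nat using (ℕ; zero; suc; _≤_; ⌈_/2⌉)
open import Data.Fin using (Fin; _≟_)
open import Data.Bool using (Bool; true; false; if_then_else_)
open import Data.List using (List; []; _∷_; _++_; length)
open import Data.List.Membership.Propositional using (_∈_)
open import Data.Product using (Σ; ∃; ∃-syntax; _×_; _,_)
open import Data.Sum using (_⊎_)
open import Relation.Nullary using (¬_)
open import Relation.Binary.PropositionalEquality using (_≡_; _≢_)
open import Function.Bundles using (_⇔_)

record Graph (n : ℕ) : Set₁ where
  field
    Edge   : Fin n → Fin n → Set
    sym    : ∀ {x y} → Edge x y → Edge y x
    irrefl : ∀ {x} → ¬ Edge x x
open Graph public

Word : ℕ → Set
Word n = List (Fin n)

restrict : ∀ {n} → (Fin n → Bool) → Word n → Word n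
restrict S [] = []
restrict S (a ∷ w) = if S a then a ∷ restrict S w else restrict S w

pair : ∀ {n} → Fin n → Fin n → Fin n → Bool
pair x y a with a ≟ x | a ≟ y
... | Relation.Nullary.yes _ | _ = true
... | Relation.Nullary.no _ | Relation.Nullary.yes _ = true
... | Relation.Nullary.no _ | Relation.Nullary.no _ = false

altWord : ∀ {n} → Fin n → Fin n → ℕ → Word n
altWord x y zero = []
altWord x y (suc k) = x ∷ altWord y x k

Alternate : ∀ {n} → Word n → Fin n → Fin n → Set
Alternate w x y =
  ∃[ k ] (restrict (pair x y) w ≡ altWord x y k ⊎ restrict (pair x y) w ≡ altWord y x k)

Represents : ∀ {n} → Word n → Graph n → Set
Represents w G =
  (∀ v → v ∈ w) × (∀ x y → x ≢ y → (Alternate w x y ⇔ Edge G x y))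

WordRepresentable : ∀ {n} → Graph n → Set
WordRepresentable G = ∃[ w ] Represents w G

occ : ∀ {n} → Fin n → Word n → ℕ
occ v [] = 0
occ v (a ∷ w) with v ≟ a
... | Relation.Nullary.yes _ = suc (occ v w)
... | Relation.Nullary.no _ = occ v w

Uniform : ∀ {n} → Word n → Set
Uniform w = ∃[ m ] (∀ v → occ v w ≡ m)

HasSquareOfLength≥ : ∀ {n} → ℕ → Word n → Set
HasSquareOfLength≥ p u =
  ∃[ A ] ∃[ X ] ∃[ B ] (u ≡ A ++ X ++ X ++ B) × (1 ≤ length X) × (p ≤ length X)

ContainsCompleteSquare : ∀ {n} → ℕ → Word n → Set
ContainsCompleteSquare p w = ∃[ S ] HasSquareOfLength≥ p (restrict S w)

CompleteSquareFree : ∀ {n} → ℕ → Word n → Set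
CompleteSquareFree p w = ¬ ContainsCompleteSquare p w

PCSFUniformRep : ∀ {n} → ℕ → Graph n → Word n → Set
PCSFUniformRep p G w =
  Uniform w × Represents w G × CompleteSquareFree p w
  × (1 ≤ p) × (p ≤ ⌈ length w /2⌉)

-- Appending to a representant w a letter x of least multiplicity, chosen to occur first among
-- such letters, creates no alternation (prefixes of alternating words alternate) and destroys
-- none: if y occurs more often than x then w_{x,y} is yx…y, and if equally often it is xy…xy,
-- because x comes first.  Repeating this until every letter occurs as often as the commonest
-- one gives a uniform representant.  If a uniform representant is a square XX, then X is uniform,
-- so each X_{x,y} is balanced, and a balanced word alternates exactly when its square does:
-- X represents the same graph.  Halving until the word is no longer a square leaves a uniform
-- representant w for which p = ⌈|w|/2⌉ works, since a complete square of that length is a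
-- subword of w at least as long as w, hence w itself.
module Submission where

open import Defs hiding (sym)
open import Data.Bool using (Bool; true; false)
open import Data.Fin using (Fin; _≟_) renaming (zero to fzero)
open import Data.List using (List; []; _∷_; _++_; [_]; length; map; take; allFin)
open import Data.List.Extrema.Nat using (argmin; argmax; f[argmin]≤f[xs]; f[xs]≤f[argmax])
open import Data.List.Membership.Propositional using (_∈_)
open import Data.List.Membership.Propositional.Properties using (∈-++⁺ˡ; ∈-++⁻; ∈-allFin; ∈-length)
open import Data.List.Properties using (≡-dec; length-++; ++-identityʳ; ++-assoc; ∷-injective; ∷-injectiveˡ)
open import Data.List.Relation.Unary.All as All using (All; []; _∷_)
open import Data.List.Relation.Unary.Any using (here; there)
open import Data.List.Relation.Unary.First as First using (First; _∷_)
open import Data.Nat using (ℕ; zero; suc; _+_; _∸_; _≤_; _<_; z≤n; s≤s; s≤s⁻¹; ⌈_/2⌉; ⌊_/2⌋; _≤?_)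
open import Data.Nat.Induction using (<-wellFounded)
open import Data.Nat.ListAction using (sum)
open import Data.Nat.Properties
  using ( ≤-refl; ≤-trans; ≤-antisym; ≤-reflexive; <⇒≱; ≰⇒>; m<1+n⇒m≤n; m≤n⇒m<n∨m≡n
        ; 1+n≢0; suc-injective; +-comm; +-identityʳ; +-mono-≤; +-monoˡ-≤; +-mono-<-≤; +-mono-≤-<
        ; +-cancelˡ-≤; m≤m+n; m≤n⇒m≤1+n; m<m+n; m+n≡0⇒m≡0; m+n≡0⇒n≡0; n≤0⇒n≡0; ∸-monoʳ-≤; ∸-monoʳ-<
        ; ⌊n/2⌋≤⌈n/2⌉; ⌊n/2⌋+⌈n/2⌉≡n; n≡⌊n+n/2⌋; n≡⌈n+n/2⌉; ⌈n/2⌉-mono)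
  renaming (_≟_ to _≟ℕ_)
open import Data.Nat.Tactic.RingSolver using (solve-∀)
open import Data.Product using (∃; ∃-syntax; _×_; _,_; proj₁; proj₂)
open import Data.Sum using (_⊎_; inj₁; inj₂; reduce)
import Data.Sum as Sum
open import Function.Bundles using (_⇔_; mk⇔)
open import Function.Properties.Equivalence using () renaming (refl to ⇔-refl; sym to ⇔-sym; trans to ⇔-trans)
open import Induction.WellFounded using (Acc; acc)
open import Relation.Nullary using (Dec; yes; no; contradiction)
open import Relation.Nullary.Decidable using (toSum)
open import Relation.Binary.PropositionalEquality
  using (_≡_; _≢_; refl; sym; trans; cong; subst; subst₂; _≗_; ≢-sym)

private variable
  N : ℕ
  S T : Fin N → Bool
  a b v x y : Fin N
  u w X : Word N

occ-here : (v : Fin N) (w : Word N) → occ v (v ∷ w) ≡ suc (occ v w)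
occ-here v w with v ≟ v
... | yes _ = refl
... | no v≢v = contradiction refl v≢v

occ-there : v ≢ a → occ v (a ∷ w) ≡ occ v w
occ-there {v = v} {a = a} v≢a with v ≟ a
... | yes v≡a = contradiction v≡a v≢a
... | no _ = refl

occ-++ : (v : Fin N) (u w : Word N) → occ v (u ++ w) ≡ occ v u + occ v w
occ-++ v [] w = refl
occ-++ v (a ∷ u) w with v ≟ a
... | yes _ = cong suc (occ-++ v u w)
... | no _ = occ-++ v u w

occ-∷ʳ-self : (x : Fin N) (w : Word N) → occ x (w ++ [ x ]) ≡ suc (occ x w)
occ-∷ʳ-self x w = trans (occ-++ x w [ x ]) (trans (cong (occ x w +_) (occ-here x [])) (+-comm (occ x w) 1))

occ-∷ʳ-other : v ≢ x → (w : Word N) → occ v (w ++ [ x ]) ≡ occ v w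
occ-∷ʳ-other {v = v} {x = x} v≢x w =
  trans (occ-++ v w [ x ]) (trans (cong (occ v w +_) (occ-there v≢x)) (+-identityʳ (occ v w)))

occ-∷ʳ-≤ : (v x : Fin N) (w : Word N) → occ v w ≤ occ v (w ++ [ x ])
occ-∷ʳ-≤ v x w = subst (occ v w ≤_) (sym (occ-++ v w [ x ])) (m≤m+n _ _)

restrict-++ : (S : Fin N → Bool) (u w : Word N) → restrict S (u ++ w) ≡ restrict S u ++ restrict S w
restrict-++ S [] w = refl
restrict-++ S (a ∷ u) w with S a
... | true = cong (a ∷_) (restrict-++ S u w)
... | false = restrict-++ S u w

restrict-∷ʳ-true : S x ≡ true → (w : Word N) → restrict S (w ++ [ x ]) ≡ restrict S w ++ [ x ]
restrict-∷ʳ-true {S = S} {x = x} Sx w rewrite restrict-++ S w [ x ] | Sx = refl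

restrict-∷ʳ-false : S x ≡ false → (w : Word N) → restrict S (w ++ [ x ]) ≡ restrict S w
restrict-∷ʳ-false {S = S} {x = x} Sx w rewrite restrict-++ S w [ x ] | Sx = ++-identityʳ _

restrict-cong : S ≗ T → (w : Word N) → restrict S w ≡ restrict T w
restrict-cong S≗T [] = refl
restrict-cong {S = S} {T = T} S≗T (a ∷ w) rewrite S≗T a with T a
... | true = cong (a ∷_) (restrict-cong S≗T w)
... | false = restrict-cong S≗T w

occ-restrict : S v ≡ true → (w : Word N) → occ v (restrict S w) ≡ occ v w
occ-restrict Sv [] = refl
occ-restrict {S = S} {v = v} Sv (a ∷ w) with v ≟ a
... | yes refl rewrite Sv = trans (occ-here v _) (cong suc (occ-restrict Sv w))
... | no v≢a with S a
...   | true = trans (occ-there v≢a) (occ-restrict Sv w)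
...   | false = occ-restrict Sv w

restrict-First : S x ≡ true → First (λ a → S a ≡ false) (_≡ x) w → ∃[ u ] restrict S w ≡ x ∷ u
restrict-First {S = S} {w = x ∷ w} Sx First.[ refl ] rewrite Sx = restrict S w , refl
restrict-First {S = S} {w = a ∷ w} Sx (Sa ∷ first) rewrite Sa = restrict-First Sx first

length-restrict : (S : Fin N → Bool) (w : Word N) → length (restrict S w) ≤ length w
length-restrict S [] = z≤n
length-restrict S (a ∷ w) with S a
... | true = s≤s (length-restrict S w)
... | false = m≤n⇒m≤1+n (length-restrict S w)

restrict-length-≥ : length w ≤ length (restrict S w) → restrict S w ≡ w
restrict-length-≥ {w = []} _ = refl
restrict-length-≥ {w = a ∷ w} {S = S} le with S a
... | true = cong (a ∷_) (restrict-length-≥ (s≤s⁻¹ le))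
... | false = contradiction le (<⇒≱ (s≤s (length-restrict S w)))

pair-left : (x y : Fin N) → pair x y x ≡ true
pair-left x y with x ≟ x
... | yes _ = refl
... | no x≢x = contradiction refl x≢x

pair-right : (x y : Fin N) → pair x y y ≡ true
pair-right x y with y ≟ x | y ≟ y
... | yes _ | _ = refl
... | no _ | yes _ = refl
... | no _ | no y≢y = contradiction refl y≢y

pair-other : a ≢ x → a ≢ y → pair x y a ≡ false
pair-other {a = a} {x = x} {y = y} a≢x a≢y with a ≟ x | a ≟ y
... | yes a≡x | _ = contradiction a≡x a≢x
... | no _ | yes a≡y = contradiction a≡y a≢y
... | no _ | no _ = refl

pair-comm : (x y : Fin N) → pair x y ≗ pair y x
pair-comm x y a with a ≟ x | a ≟ y
... | yes _ | yes _ = refl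
... | yes _ | no _ = refl
... | no _ | yes _ = refl
... | no _ | no _ = refl

Alternating : Word N → Fin N → Fin N → Set
Alternating u x y = ∃[ k ] (u ≡ altWord x y k ⊎ u ≡ altWord y x k)

occ-a∷b∷w : a ≢ b → (w : Word N) →
            occ a (a ∷ b ∷ w) ≡ suc (occ a w) × occ b (a ∷ b ∷ w) ≡ suc (occ b w)
occ-a∷b∷w {a = a} {b = b} a≢b w =
  trans (occ-here a (b ∷ w)) (cong suc (occ-there a≢b)) , trans (occ-there (≢-sym a≢b)) (occ-here b w)

occ-altWord-≤ : a ≢ b → ∀ k → occ b (altWord a b k) ≤ occ a (altWord a b k)
occ-altWord-≤ a≢b zero = z≤n
occ-altWord-≤ a≢b (suc zero) = ≤-trans (≤-reflexive (occ-there (≢-sym a≢b))) z≤n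
occ-altWord-≤ {a = a} {b = b} a≢b (suc (suc k)) =
  subst₂ _≤_ (sym eb) (sym ea) (s≤s (occ-altWord-≤ a≢b k))
  where
  ea = proj₁ (occ-a∷b∷w a≢b (altWord a b k))
  eb = proj₂ (occ-a∷b∷w a≢b (altWord a b k))

-- Balanced means k is even, so the second word continues the alternation.
altWord-++ : a ≢ b → ∀ k m → occ a (altWord a b k) ≡ occ b (altWord a b k) →
             altWord a b k ++ altWord a b m ≡ altWord a b (k + m)
altWord-++ a≢b zero m _ = refl
altWord-++ {a = a} {b = b} a≢b (suc zero) m balanced =
  contradiction (trans (sym (occ-here a [])) (trans balanced (occ-there (≢-sym a≢b)))) 1+n≢0
altWord-++ {a = a} {b = b} a≢b (suc (suc k)) m balanced =
  cong (λ t → a ∷ b ∷ t) (altWord-++ a≢b k m (suc-injective (trans (sym ea) (trans balanced eb))))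
  where
  ea = proj₁ (occ-a∷b∷w a≢b (altWord a b k))
  eb = proj₂ (occ-a∷b∷w a≢b (altWord a b k))

altWord-∷ʳ-balanced : a ≢ b → ∀ k → occ a (altWord a b k) ≡ occ b (altWord a b k) →
                      altWord a b k ++ [ a ] ≡ altWord a b (suc k)
altWord-∷ʳ-balanced {a = a} {b = b} a≢b k balanced =
  trans (altWord-++ a≢b k 1 balanced) (cong (altWord a b) (+-comm k 1))

altWord-∷ʳ-unbalanced : a ≢ b → ∀ k → occ b (altWord a b k) < occ a (altWord a b k) →
                        altWord a b k ++ [ b ] ≡ altWord a b (suc k)
altWord-∷ʳ-unbalanced {a = a} {b = b} a≢b (suc k) b<a =
  cong (a ∷_) (altWord-∷ʳ-balanced (≢-sym a≢b) k
                 (≤-antisym (m<1+n⇒m≤n b<a′) (occ-altWord-≤ (≢-sym a≢b) k)))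
  where
  b<a′ : occ b (altWord b a k) < suc (occ a (altWord b a k))
  b<a′ = subst₂ _<_ (occ-there (≢-sym a≢b)) (occ-here a _) b<a

altWord-prefix : (r : Word N) {s : Word N} (k : ℕ) → r ++ s ≡ altWord a b k → r ≡ altWord a b (length r)
altWord-prefix [] k _ = refl
altWord-prefix (c ∷ r) zero ()
altWord-prefix (c ∷ r) (suc k) e with ∷-injective e
... | refl , e′ = cong (c ∷_) (altWord-prefix r k e′)

Alternating-resp : u ≡ w → Alternating u x y ⇔ Alternating w x y
Alternating-resp refl = ⇔-refl

Alternating-swap : Alternating u x y → Alternating u y x
Alternating-swap (k , e) = k , Sum.swap e

Alternating-prefix : Alternating (u ++ w) x y → Alternating u x y
Alternating-prefix {u = u} (k , inj₁ e) = length u , inj₁ (altWord-prefix u k e)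
Alternating-prefix {u = u} (k , inj₂ e) = length u , inj₂ (altWord-prefix u k e)

Alternating-++-self : x ≢ y → occ x u ≡ occ y u → Alternating u x y → Alternating (u ++ u) x y
Alternating-++-self x≢y balanced (k , inj₁ refl) = k + k , inj₁ (altWord-++ x≢y k k balanced)
Alternating-++-self x≢y balanced (k , inj₂ refl) = k + k , inj₂ (altWord-++ (≢-sym x≢y) k k (sym balanced))

Alternating-∷ʳ : x ≢ y → occ x u ≤ occ y u → (occ x u ≡ occ y u → ∃[ u′ ] u ≡ x ∷ u′) →
                 Alternating u x y → Alternating (u ++ [ x ]) x y
Alternating-∷ʳ x≢y x≤y _ (k , inj₁ refl) =
  suc k , inj₁ (altWord-∷ʳ-balanced x≢y k (≤-antisym x≤y (occ-altWord-≤ x≢y k)))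
Alternating-∷ʳ x≢y _ startsWithX (zero , inj₂ refl) with startsWithX refl
... | _ , ()
Alternating-∷ʳ x≢y _ startsWithX (suc k , inj₂ refl)
  with m≤n⇒m<n∨m≡n (occ-altWord-≤ (≢-sym x≢y) (suc k))
... | inj₁ x<y = suc (suc k) , inj₂ (altWord-∷ʳ-unbalanced (≢-sym x≢y) (suc k) x<y)
... | inj₂ x≡y = contradiction (∷-injectiveˡ (proj₂ (startsWithX x≡y))) (≢-sym x≢y)

Alternate-comm : (w : Word N) (x y : Fin N) → Alternate w x y ⇔ Alternate w y x
Alternate-comm w x y = mk⇔ (swapped x y) (swapped y x)
  where
  swapped : ∀ x y → Alternate w x y → Alternate w y x
  swapped x y alt = subst (λ t → Alternating t y x) (restrict-cong (pair-comm x y) w) (Alternating-swap alt)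

Alternate-∷ʳ : (w : Word N) → x ≢ y → occ x w ≤ occ y w →
               (occ x w ≡ occ y w → ∃[ u ] restrict (pair x y) w ≡ x ∷ u) →
               Alternate w x y ⇔ Alternate (w ++ [ x ]) x y
Alternate-∷ʳ {x = x} {y = y} w x≢y x≤y startsWithX =
  ⇔-trans (mk⇔ (Alternating-∷ʳ x≢y x≤y′ startsWithX′) (Alternating-prefix {w = [ x ]}))
          (Alternating-resp (sym (restrict-∷ʳ-true (pair-left x y) w)))
  where
  occ-x = occ-restrict (pair-left x y) w
  occ-y = occ-restrict (pair-right x y) w
  x≤y′ : occ x (restrict (pair x y) w) ≤ occ y (restrict (pair x y) w)
  x≤y′ = subst₂ _≤_ (sym occ-x) (sym occ-y) x≤y
  startsWithX′ : occ x (restrict (pair x y) w) ≡ occ y (restrict (pair x y) w) →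
                 ∃[ u ] restrict (pair x y) w ≡ x ∷ u
  startsWithX′ balanced = startsWithX (trans (sym occ-x) (trans balanced occ-y))

Alternate-∷ʳ-other : (w : Word N) → a ≢ x → b ≢ x → Alternate w a b ⇔ Alternate (w ++ [ x ]) a b
Alternate-∷ʳ-other w a≢x b≢x =
  Alternating-resp (sym (restrict-∷ʳ-false (pair-other (≢-sym a≢x) (≢-sym b≢x)) w))

Alternate-++-self : (X : Word N) → a ≢ b → occ a X ≡ occ b X → Alternate X a b ⇔ Alternate (X ++ X) a b
Alternate-++-self {a = a} {b = b} X a≢b balanced =
  ⇔-trans (mk⇔ (Alternating-++-self a≢b balanced′) (Alternating-prefix {w = restrict (pair a b) X}))
          (Alternating-resp (sym (restrict-++ (pair a b) X X)))
  where
  balanced′ : occ a (restrict (pair a b) X) ≡ occ b (restrict (pair a b) X)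
  balanced′ = trans (occ-restrict (pair-left a b) X) (trans balanced (sym (occ-restrict (pair-right a b) X)))

Represents-transfer : {G : Graph N} → (∀ v → v ∈ w → v ∈ u) →
                      (∀ x y → x ≢ y → Alternate w x y ⇔ Alternate u x y) →
                      Represents w G → Represents u G
Represents-transfer letters alternations (contains , represents) =
  (λ v → letters v (contains v)) ,
  λ x y x≢y → ⇔-trans (⇔-sym (alternations x y x≢y)) (represents x y x≢y)

LeftmostRarest : Word N → Fin N → Set
LeftmostRarest w x = (∀ v → occ x w ≤ occ v w) × First (λ a → occ a w ≢ occ x w) (_≡ x) w

rarestLetter : (w : Word (suc N)) → ∃[ x ] ∀ v → occ x w ≤ occ v w
rarestLetter w =
  argmin f fzero letters , λ v → All.lookup (f[argmin]≤f[xs] {f = f} fzero letters) (∈-allFin v)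
  where
  f = λ v → occ v w
  letters = allFin _

commonestLetter : (w : Word (suc N)) → ∃[ x ] ∀ v → occ v w ≤ occ x w
commonestLetter w =
  argmax f fzero letters , λ v → All.lookup (f[xs]≤f[argmax] {f = f} fzero letters) (∈-allFin v)
  where
  f = λ v → occ v w
  letters = allFin _

First-witness : {A : Set} {P Q : A → Set} {xs : List A} → First P Q xs → ∃[ x ] Q x × First P (_≡ x) xs
First-witness First.[ qx ] = _ , qx , First.[ refl ]
First-witness (px ∷ first) with First-witness first
... | x , qx , first′ = x , qx , px ∷ first′

leftmostRarest : (w : Word (suc N)) → (∀ v → v ∈ w) → ∃ (LeftmostRarest w)
leftmostRarest w contains = firstOfCount (rarestLetter w)
  where
  firstOfCount : (∃[ x₀ ] ∀ v → occ x₀ w ≤ occ v w) → ∃ (LeftmostRarest w)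
  firstOfCount (x₀ , x₀-rarest) with First.first (λ a → Sum.swap (toSum (occ a w ≟ℕ occ x₀ w))) w
  ... | inj₂ noneRarest = contradiction refl (All.lookup noneRarest (contains x₀))
  ... | inj₁ first with First-witness first
  ...   | x , x≡x₀ , first′ =
    x , (λ v → subst (_≤ occ v w) (sym x≡x₀) (x₀-rarest v)) ,
    First.map₁ (λ ≢x₀ ≡x → ≢x₀ (trans ≡x x≡x₀)) first′

LeftmostRarest-startsFirst : LeftmostRarest w x → occ x w ≡ occ y w → ∃[ u ] restrict (pair x y) w ≡ x ∷ u
LeftmostRarest-startsFirst {w = w} {x = x} {y = y} (_ , first) x≡y =
  restrict-First (pair-left x y) (First.map₁ outside-pair first)
  where
  outside-pair : ∀ {a} → occ a w ≢ occ x w → pair x y a ≡ false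
  outside-pair not-rarest =
    pair-other (λ a≡x → not-rarest (cong (λ t → occ t w) a≡x))
               (λ a≡y → not-rarest (trans (cong (λ t → occ t w) a≡y) (sym x≡y)))

Alternate-∷ʳ-rarest : LeftmostRarest w x → a ≢ b → Alternate w a b ⇔ Alternate (w ++ [ x ]) a b
Alternate-∷ʳ-rarest {w = w} {x = x} {a = a} {b = b} lr a≢b with a ≟ x | b ≟ x
... | yes refl | _ = Alternate-∷ʳ w a≢b (proj₁ lr b) (LeftmostRarest-startsFirst lr)
... | no _ | yes refl =
  ⇔-trans (Alternate-comm w a b)
    (⇔-trans (Alternate-∷ʳ w (≢-sym a≢b) (proj₁ lr a) (LeftmostRarest-startsFirst lr))
             (Alternate-comm (w ++ [ b ]) b a))
... | no a≢x | no b≢x = Alternate-∷ʳ-other w a≢x b≢x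

Represents-∷ʳ-rarest : {G : Graph N} → LeftmostRarest w x → Represents w G → Represents (w ++ [ x ]) G
Represents-∷ʳ-rarest {G = G} lr =
  Represents-transfer {G = G} (λ _ → ∈-++⁺ˡ) (λ _ _ → Alternate-∷ʳ-rarest lr)

deficit : ℕ → Word N → ℕ
deficit M w = sum (map (λ v → M ∸ occ v w) (allFin _))

module _ {A : Set} {f g : A → ℕ} (f≤g : ∀ a → f a ≤ g a) where

  sum-map-≤ : (xs : List A) → sum (map f xs) ≤ sum (map g xs)
  sum-map-≤ [] = z≤n
  sum-map-≤ (a ∷ xs) = +-mono-≤ (f≤g a) (sum-map-≤ xs)

  sum-map-< : {a : A} {xs : List A} → a ∈ xs → f a < g a → sum (map f xs) < sum (map g xs)
  sum-map-< {xs = _ ∷ xs} (here refl) fa<ga = +-mono-<-≤ fa<ga (sum-map-≤ xs)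
  sum-map-< (there a∈xs) fa<ga = +-mono-≤-< (f≤g _) (sum-map-< a∈xs fa<ga)

deficit-∷ʳ : (M : ℕ) (w : Word N) → occ x w < M → deficit M (w ++ [ x ]) < deficit M w
deficit-∷ʳ {x = x} M w x<M =
  sum-map-< (λ v → ∸-monoʳ-≤ M (occ-∷ʳ-≤ v x w)) (∈-allFin x) (∸-monoʳ-< x<x′ x′≤M)
  where
  x<x′ : occ x w < occ x (w ++ [ x ])
  x<x′ = ≤-reflexive (sym (occ-∷ʳ-self x w))
  x′≤M : occ x (w ++ [ x ]) ≤ M
  x′≤M = subst (_≤ M) (sym (occ-∷ʳ-self x w)) x<M

module _ {n : ℕ} {G : Graph (suc n)} where

  uniformize : (M : ℕ) (w : Word (suc n)) → Acc _<_ (deficit M w) →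
               Represents w G → (∀ v → occ v w ≤ M) → ∃[ u ] Represents u G × Uniform u
  uniformize M w (acc smaller) rep bounded = extend (leftmostRarest w (proj₁ rep))
    where
    extend : ∃ (LeftmostRarest w) → ∃[ u ] Represents u G × Uniform u
    extend (x , lr) with M ≤? occ x w
    ... | yes M≤x = w , rep , M , λ v → ≤-antisym (bounded v) (≤-trans M≤x (proj₁ lr v))
    ... | no M≰x =
      uniformize M (w ++ [ x ]) (smaller (deficit-∷ʳ M w x<M)) (Represents-∷ʳ-rarest {G = G} lr rep) bounded′
      where
      x<M = ≰⇒> M≰x
      bounded′ : ∀ v → occ v (w ++ [ x ]) ≤ M
      bounded′ v with v ≟ x
      ... | yes refl = subst (_≤ M) (sym (occ-∷ʳ-self x w)) x<M
      ... | no v≢x = subst (_≤ M) (sym (occ-∷ʳ-other v≢x w)) (bounded v)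

  uniformRepresentation : {w : Word (suc n)} → Represents w G → ∃[ u ] Represents u G × Uniform u
  uniformRepresentation {w = w} rep =
    uniformize (occ (proj₁ (commonestLetter w)) w) w (<-wellFounded _) rep (proj₂ (commonestLetter w))

IsSquare : Word N → Set
IsSquare w = ∃[ X ] w ≡ X ++ X

firstHalf : Word N → Word N
firstHalf w = take ⌈ length w /2⌉ w

take-length-++ : {A : Set} (xs ys : List A) → take (length xs) (xs ++ ys) ≡ xs
take-length-++ [] ys = refl
take-length-++ (x ∷ xs) ys = cong (x ∷_) (take-length-++ xs ys)

firstHalf-++-self : (X : Word N) → firstHalf (X ++ X) ≡ X
firstHalf-++-self X rewrite length-++ X {X} | sym (n≡⌈n+n/2⌉ (length X)) = take-length-++ X X

isSquare? : (w : Word N) → Dec (IsSquare w)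
isSquare? w with ≡-dec _≟_ w (firstHalf w ++ firstHalf w)
... | yes w≡halves = yes (firstHalf w , w≡halves)
... | no w≢halves =
  no λ (X , w≡XX) → w≢halves (subst (λ t → t ≡ firstHalf t ++ firstHalf t) (sym w≡XX) (XX≡halves X))
  where
  XX≡halves : (X : Word N) → X ++ X ≡ firstHalf (X ++ X) ++ firstHalf (X ++ X)
  XX≡halves X rewrite firstHalf-++-self X = refl

n≤⌈n/2⌉+⌈n/2⌉ : ∀ n → n ≤ ⌈ n /2⌉ + ⌈ n /2⌉
n≤⌈n/2⌉+⌈n/2⌉ n =
  ≤-trans (≤-reflexive (sym (⌊n/2⌋+⌈n/2⌉≡n n))) (+-monoˡ-≤ ⌈ n /2⌉ (⌊n/2⌋≤⌈n/2⌉ n))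

m+[n+o]≤n⇒m≡0×o≡0 : ∀ m n o → m + (n + o) ≤ n → m ≡ 0 × o ≡ 0
m+[n+o]≤n⇒m≡0×o≡0 m n o le = m+n≡0⇒m≡0 m m+o≡0 , m+n≡0⇒n≡0 m m+o≡0
  where
  rearrange : ∀ m n o → m + (n + o) ≡ n + (m + o)
  rearrange = solve-∀
  m+o≡0 : m + o ≡ 0
  m+o≡0 = n≤0⇒n≡0 (+-cancelˡ-≤ n (m + o) 0 (subst₂ _≤_ (rearrange m n o) (sym (+-identityʳ n)) le))

length≡0⇒≡[] : {A : Set} {xs : List A} → length xs ≡ 0 → xs ≡ []
length≡0⇒≡[] {xs = []} _ = refl

≤-length-infix⇒≡ : {A : Set} (B Z C : List A) → length (B ++ Z ++ C) ≤ length Z → B ++ Z ++ C ≡ Z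
≤-length-infix⇒≡ B Z C le
  with m+[n+o]≤n⇒m≡0×o≡0 (length B) (length Z) (length C)
         (subst (_≤ length Z) (trans (length-++ B) (cong (length B +_) (length-++ Z))) le)
... | |B|≡0 , |C|≡0
  rewrite length≡0⇒≡[] {xs = B} |B|≡0 | length≡0⇒≡[] {xs = C} |C|≡0 = ++-identityʳ Z

longCompleteSquare⇒IsSquare : ContainsCompleteSquare ⌈ length w /2⌉ w → IsSquare w
longCompleteSquare⇒IsSquare {w = w} (S , B , Y , C , w|S≡BYYC , _ , half≤Y) =
  Y , trans (sym (restrict-length-≥ (≤-trans w≤YY (≤-reflexive (cong length (sym w|S≡YY)))))) w|S≡YY
  where
  w≤YY : length w ≤ length (Y ++ Y)
  w≤YY = ≤-trans (n≤⌈n/2⌉+⌈n/2⌉ (length w))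
                 (subst (_ ≤_) (sym (length-++ Y)) (+-mono-≤ half≤Y half≤Y))
  w|S≡B[YY]C : restrict S w ≡ B ++ (Y ++ Y) ++ C
  w|S≡B[YY]C = trans w|S≡BYYC (cong (B ++_) (sym (++-assoc Y Y C)))
  w|S≡YY : restrict S w ≡ Y ++ Y
  w|S≡YY = trans w|S≡B[YY]C (≤-length-infix⇒≡ B (Y ++ Y) C
             (subst (λ t → length t ≤ length (Y ++ Y)) w|S≡B[YY]C (≤-trans (length-restrict S w) w≤YY)))

Uniform-half : (X : Word N) → Uniform (X ++ X) → Uniform X
Uniform-half X (m , uniform) =
  ⌊ m /2⌋ , λ v → trans (n≡⌊n+n/2⌋ (occ v X)) (cong ⌊_/2⌋ (trans (sym (occ-++ v X X)) (uniform v)))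

Represents-half : {G : Graph N} (X : Word N) → Uniform (X ++ X) → Represents (X ++ X) G → Represents X G
Represents-half {G = G} X uniform =
  Represents-transfer {G = G} (λ _ v∈XX → reduce (∈-++⁻ X v∈XX))
                              (λ a b a≢b → ⇔-sym (Alternate-++-self X a≢b (balanced a b)))
  where
  balanced : ∀ a b → occ a X ≡ occ b X
  balanced a b = trans (proj₂ (Uniform-half X uniform) a) (sym (proj₂ (Uniform-half X uniform) b))

module _ {n : ℕ} {G : Graph (suc n)} where

  squareFreeRepresentation : (w : Word (suc n)) → Acc _<_ (length w) → Represents w G → Uniform w →
                             ∃[ p ] ∃[ u ] PCSFUniformRep p G u
  squareFreeRepresentation w (acc shorter) rep uniform with isSquare? w
  ... | yes (X , refl) = squareFreeRepresentation X (shorter X<XX) repX (Uniform-half X uniform)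
    where
    repX = Represents-half {G = G} X uniform rep
    X<XX : length X < length (X ++ X)
    X<XX = subst (length X <_) (sym (length-++ X)) (m<m+n (length X) (∈-length (proj₁ repX fzero)))
  ... | no notSquare =
    ⌈ length w /2⌉ , w , uniform , rep , (λ square → notSquare (longCompleteSquare⇒IsSquare square)) ,
    ⌈n/2⌉-mono (∈-length (proj₁ rep fzero)) , ≤-refl

mainTheorem13 : (n : ℕ) (G : Graph (suc n)) →
    WordRepresentable G ⇔ (∃[ p ] ∃[ w ] PCSFUniformRep p G w)
mainTheorem13 n G = mk⇔ squareFree forget
  where
  squareFree : WordRepresentable G → ∃[ p ] ∃[ w ] PCSFUniformRep p G w
  squareFree (w , rep) = halve (uniformRepresentation {G = G} rep)
    where
    halve : ∃[ u ] Represents u G × Uniform u → ∃[ p ] ∃[ w ] PCSFUniformRep p G w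
    halve (u , repU , uniformU) = squareFreeRepresentation {G = G} u (<-wellFounded _) repU uniformU
  forget : (∃[ p ] ∃[ w ] PCSFUniformRep p G w) → WordRepresentable G
  forget (_ , w , _ , rep , _) = w , rep
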